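{- Suppose that $a,b\geqslant 7$ are integers such that $a\equiv b\equiv 3\pmod 4$. There exists a signed magic array set $\mathrm{SMAS}(a,b;2)$.
   Context: For positive integers $a,b,e$, a signed magic array set $\mathrm{SMAS}(a,b;e)$ is a set of $e$ (completely filled) arrays of size $a\times b$ with entries in $\Omega\subset\mathbb{Z}$, where $\Omega=\{0,\pm1,\pm2,\ldots,\pm(abe-1)/2\}$ if $abe$ is odd and $\Omega=\{\pm1,\pm2,\ldots,\pm abe/2\}$ if $abe$ is even, such that (a) every $\omega\in\Omega$ appears exactly once and in a unique array; (b) for every array, the sum of the elements in each row and in each column is $0$. -}

module Defs where

open import Data.Nat as ℕ using (ℕ; _*_; _%_; _/_; _∸_)
open import Data.Integer as ℤ using (ℤ; ∣_∣; 0ℤ)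
open import Data.Fin using (Fin)
open import Data.Product using (Σ; _×_; _,_; ∃; ∃-syntax)
open import Data.Vec.Functional using (Vector)
open import Data.Vec.Functional as VF using ()
open import Relation.Binary.PropositionalEquality using (_≡_)
open import Relation.Nullary using (¬_)

sumℤ : ∀ {n} → (Fin n → ℤ) → ℤ
sumℤ {n} f = VF.foldr ℤ._+_ 0ℤ f

Ω : ℕ → ℤ → Set
Ω N z with N % 2
... | 0 = ¬ (z ≡ 0ℤ) × (∣ z ∣ ℕ.≤ N / 2)
... | _ = ∣ z ∣ ℕ.≤ (N ∸ 1) / 2

Arrays : ℕ → ℕ → ℕ → Set
Arrays a b e = Fin e → Fin a → Fin b → ℤ

record IsSMAS (a b e : ℕ) (A : Arrays a b e) : Set where
  field
    entries-in-Ω : ∀ k i j → Ω (a * b * e) (A k i j)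
    each-once    : ∀ ω → Ω (a * b * e) ω →
                   Σ (Fin e × Fin a × Fin b) λ { (k , i , j) →
                     (A k i j ≡ ω) ×
                     (∀ k' i' j' → A k' i' j' ≡ ω → (k' , i' , j') ≡ (k , i , j)) }
    rows-zero    : ∀ k i → sumℤ (λ j → A k i j) ≡ 0ℤ
    cols-zero    : ∀ k j → sumℤ (λ i → A k i j) ≡ 0ℤ

SMAS : ℕ → ℕ → ℕ → Set
SMAS a b e = Σ (Arrays a b e) (IsSMAS a b e)

module Submission where

-- Write a = 3 + 4p, b = 3 + 4q with q ≥ 1, and M = 2(p + q − 1).  Each array has three border rows
-- and columns followed by blocks of four.  The body (blocks × blocks) carries the values 6M + 22, …, ab
-- in order, signed by (+, −, −, +) along every block row and column; this pattern kills arithmetic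
-- progressions, so the body lines vanish.  Where the border crosses the blocks sit 4 × 3 families with
-- rows ±(x, y, −(x + y)), x and y affine in a parameter t taking two consecutive values, with slopes
-- chosen so that (+, −, −, +) cancels the family columns as well; the 3 × 3 corner and the 3 × 4 gadget
-- next to it take the remaining small values.  The second array is the negative of the first, with a
-- different gadget.  Every entry is ± the u-th value of some segment r of 1, …, ab (the segments have
-- lengths affine in M), and its position can be read off from (±, r, u).  So the 2ab entries are
-- distinct, and as there are exactly 2ab admissible values, each of them occurs exactly once.

open import Defs
open import Data.Empty using (⊥)
open import Data.Fin as Fin using (Fin; toℕ; fromℕ<)
open import Data.Fin.Patterns using (0F; 1F; 2F; 3F)
import Data.Fin.Properties as FinP
open import Data.Fin.Properties using (all?)
open import Data.Integer using (ℤ; +_; -[1+_]; 0ℤ; ∣_∣; -_; sign; _+_; _*_; _-_)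
import Data.Integer as ℤ
import Data.Integer.Properties as ℤP
open import Data.Integer.Tactic.RingSolver using (solve-∀; solve)
open import Data.List using (List; []; _∷_; take; map; _++_; allFin; cartesianProduct; find)
open import Data.Maybe using (just; nothing)
open import Data.Nat as ℕ using (ℕ; zero; suc; _≤_; _<_; _%_; _/_; _∸_)
import Data.Nat.DivMod as ℕD
import Data.Nat.Divisibility as ℕDiv
open import Data.Nat.ListAction using (sum)
import Data.Nat.Properties as ℕP
import Data.Nat.Tactic.RingSolver as ℕSolver
open import Data.Product using (Σ; _×_; _,_; ∃; proj₁; proj₂; map₁; uncurry)
open import Data.Product.Function.NonDependent.Propositional using (_×-↔_)
open import Data.Product.Properties using (≡-dec)
open import Data.Sign as Sign using (Sign) renaming (+ to ⊕; - to ⊖)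
import Data.Sign.Properties as SignP
open import Data.Unit using (⊤; tt)
open import Function using (_∘_; id)
open import Function.Bundles using (Inverse; _↔_; _⇔_; mk⇔; Equivalence)
open import Function.Definitions using (Injective)
open import Function.Properties.Inverse using (↔-sym; ↔-trans; ↔-refl)
open import Relation.Binary.Definitions using (DecidableEquality)
open import Relation.Binary.PropositionalEquality
open import Relation.Nullary using (Dec; yes; no; _×-dec_)
open import Relation.Nullary.Decidable using (map′; from-yes)
open import Relation.Nullary.Negation using (contradiction)

infixr 8 _·_

_·_ : Sign → ℤ → ℤ
⊕ · x = x
⊖ · x = - x

·-* : ∀ s t x → (s Sign.* t) · x ≡ s · (t · x)
·-* ⊕ t x = refl
·-* ⊖ ⊕ x = refl
·-* ⊖ ⊖ x = sym (ℤP.neg-involutive x)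

·-comm : ∀ s t x → s · (t · x) ≡ t · (s · x)
·-comm s t x = trans (sym (·-* s t x)) (trans (cong (_· x) (SignP.*-comm s t)) (·-* t s x))

·-*-* : ∀ s t u x → (s Sign.* (t Sign.* u)) · x ≡ s · (t · (u · x))
·-*-* s t u x = trans (·-* s _ x) (cong (s ·_) (·-* t u x))

·-zero : ∀ s → s · 0ℤ ≡ 0ℤ
·-zero ⊕ = refl
·-zero ⊖ = refl

sign-· : ∀ s v → sign (s · + suc v) ≡ s
sign-· ⊕ v = refl
sign-· ⊖ v = refl

abs-· : ∀ s v → ∣ s · + v ∣ ≡ v
abs-· ⊕ v = refl
abs-· ⊖ zero = refl
abs-· ⊖ (suc v) = refl

sumℤ-cong : ∀ {n} {f g : Fin n → ℤ} → (∀ i → f i ≡ g i) → sumℤ f ≡ sumℤ g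
sumℤ-cong {zero}  f≡g = refl
sumℤ-cong {suc n} f≡g = cong₂ _+_ (f≡g 0F) (sumℤ-cong (f≡g ∘ Fin.suc))

sumℤ-· : ∀ {n} s (f : Fin n → ℤ) → sumℤ (λ j → s · f j) ≡ s · sumℤ f
sumℤ-· {zero} s f = sym (·-zero s)
sumℤ-· {suc n} ⊕ f = refl
sumℤ-· {suc n} ⊖ f = begin
  - f 0F + sumℤ (λ j → - f (Fin.suc j))  ≡⟨ cong (λ z → - f 0F + z) (sumℤ-· ⊖ (f ∘ Fin.suc)) ⟩
  - f 0F + - sumℤ (f ∘ Fin.suc)           ≡⟨ ℤP.neg-distrib-+ (f 0F) _ ⟨
  - sumℤ f                                ∎
  where open ≡-Reasoning

sumℤ-·≡0 : ∀ {n} s (f : Fin n → ℤ) → sumℤ f ≡ 0ℤ → sumℤ (λ j → s · f j) ≡ 0ℤ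
sumℤ-·≡0 s f sum≡0 = trans (sumℤ-· s f) (trans (cong (s ·_) sum≡0) (·-zero s))

∑ : ℕ → (ℕ → ℤ) → ℤ
∑ zero f = 0ℤ
∑ (suc n) f = f 0 + ∑ n (f ∘ suc)

sumℤ-toℕ : ∀ n (f : ℕ → ℤ) → sumℤ {n} (f ∘ toℕ) ≡ ∑ n f
sumℤ-toℕ zero f = refl
sumℤ-toℕ (suc n) f = cong (λ z → f 0 + z) (sumℤ-toℕ n (f ∘ suc))

-- Lines of an array

data Line : Set where
  border : Fin 3 → Line
  block  : ℕ → Fin 4 → Line

_≟ᴸ_ : DecidableEquality Line
border i  ≟ᴸ border j  = map′ (cong border) (λ { refl → refl }) (i FinP.≟ j)
block g k ≟ᴸ block h l = map′ (λ { (refl , refl) → refl }) (λ { refl → refl , refl }) ((g ℕ.≟ h) ×-dec (k FinP.≟ l))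
border _  ≟ᴸ block _ _ = no λ ()
block _ _ ≟ᴸ border _  = no λ ()

blockOf : ℕ → ℕ × Fin 4
blockOf 0 = 0 , 0F
blockOf 1 = 0 , 1F
blockOf 2 = 0 , 2F
blockOf 3 = 0 , 3F
blockOf (suc (suc (suc (suc j)))) = map₁ suc (blockOf j)

line : ℕ → Line
line 0 = border 0F
line 1 = border 1F
line 2 = border 2F
line (suc (suc (suc j))) = let (g , k) = blockOf j in block g k

index : Line → ℕ
index (border i) = toℕ i
index (block g k) = 3 ℕ.+ (g ℕ.* 4 ℕ.+ toℕ k)

index-line : ∀ x → index (line x) ≡ x
index-line 0 = refl
index-line 1 = refl
index-line 2 = refl
index-line (suc (suc (suc j))) = cong (3 ℕ.+_) (blockOf-index j)
  where
  blockOf-index : ∀ j → proj₁ (blockOf j) ℕ.* 4 ℕ.+ toℕ (proj₂ (blockOf j)) ≡ j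
  blockOf-index 0 = refl
  blockOf-index 1 = refl
  blockOf-index 2 = refl
  blockOf-index 3 = refl
  blockOf-index (suc (suc (suc (suc j)))) = cong (4 ℕ.+_) (blockOf-index j)

line-injective : ∀ {x y} → line x ≡ line y → x ≡ y
line-injective {x} {y} eq = trans (sym (index-line x)) (trans (cong index eq) (index-line y))

ValidLine : ℕ → Line → Set
ValidLine k (border i) = ⊤
ValidLine k (block g l) = g < k

line-valid : ∀ k x → x < 3 ℕ.+ k ℕ.* 4 → ValidLine k (line x)
line-valid k x x< = valid (line x) (subst (_< 3 ℕ.+ k ℕ.* 4) (sym (index-line x)) x<)
  where
  valid : ∀ L → index L < 3 ℕ.+ k ℕ.* 4 → ValidLine k L
  valid (border i)  _ = tt
  valid (block g l) (ℕ.s≤s (ℕ.s≤s (ℕ.s≤s g*4+l<k*4))) =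
    ℕP.*-cancelʳ-< 4 g k (ℕP.≤-<-trans (ℕP.m≤m+n (g ℕ.* 4) (toℕ l)) g*4+l<k*4)

∑-blocks : ∀ k (f : ℕ → Fin 4 → ℤ) → (∀ g → sumℤ (f g) ≡ 0ℤ) → ∑ (k ℕ.* 4) (uncurry f ∘ blockOf) ≡ 0ℤ
∑-blocks zero f _ = refl
∑-blocks (suc k) f block-sum =
  trans (cong (λ z → f 0 0F + (f 0 1F + (f 0 2F + (f 0 3F + z)))) (∑-blocks k (f ∘ suc) (block-sum ∘ suc)))
        (block-sum 0)

∑-lines : ∀ k (c : Line → ℤ) → sumℤ (c ∘ border) ≡ 0ℤ → (∀ g → sumℤ (c ∘ block g) ≡ 0ℤ) →
          ∑ (3 ℕ.+ k ℕ.* 4) (c ∘ line) ≡ 0ℤ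
∑-lines k c border-sum block-sum =
  trans (cong (λ z → c (border 0F) + (c (border 1F) + (c (border 2F) + z))) (∑-blocks k (λ g → c ∘ block g) block-sum))
        border-sum

-- Cancelling patterns

blockSign : Fin 4 → Sign
blockSign 0F = ⊕
blockSign 1F = ⊖
blockSign 2F = ⊖
blockSign 3F = ⊕

alternating-progression : ∀ (f : Fin 4 → ℕ) c d → (∀ l → f l ≡ c ℕ.+ toℕ l ℕ.* d) →
                          sumℤ (λ l → blockSign l · + f l) ≡ 0ℤ
alternating-progression f c d f≡ = trans (sumℤ-cong (λ l → cong (λ v → blockSign l · v) (+progression l)))
                                         (annihilates (+ c) (+ d))
  where
  +progression : ∀ l → + f l ≡ + c + + toℕ l * + d
  +progression l = trans (cong +_ (f≡ l)) (trans (ℤP.pos-+ c _) (cong (λ z → + c + z) (ℤP.pos-* (toℕ l) d)))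
  annihilates : ∀ c d → c + + 0 * d + (- (c + + 1 * d) + (- (c + + 2 * d) + (c + + 3 * d + 0ℤ))) ≡ 0ℤ
  annihilates = solve-∀

triple : ℤ × ℤ → Fin 3 → ℤ
triple (x , y) 0F = x
triple (x , y) 1F = y
triple (x , y) 2F = - (x + y)

triple-sum : ∀ xy → sumℤ (triple xy) ≡ 0ℤ
triple-sum (x , y) = cancel x y
  where
  cancel : ∀ x y → x + (y + (- (x + y) + 0ℤ)) ≡ 0ℤ
  cancel = solve-∀

-- Signed linear terms in m

infix 9 _[_m+_]

data Term : Set where
  _[_m+_] : Sign → ℕ → ℕ → Term

eval : ℤ → Term → ℤ
eval m (σ [ a m+ b ]) = σ · (+ a * m + + b)

coefficient constant : Term → ℤ
coefficient (σ [ a m+ b ]) = σ · + a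
constant    (σ [ a m+ b ]) = σ · + b

eval-linear : ∀ m t → eval m t ≡ coefficient t * m + constant t
eval-linear m (⊕ [ a m+ b ]) = refl
eval-linear m (⊖ [ a m+ b ]) = trans (ℤP.neg-distrib-+ (+ a * m) (+ b)) (cong (_+ - + b) (ℤP.neg-distribˡ-* (+ a) m))

Balanced : ∀ {n} → (Fin n → Term) → Set
Balanced f = sumℤ (coefficient ∘ f) ≡ 0ℤ × sumℤ (constant ∘ f) ≡ 0ℤ

balanced? : ∀ {n} (f : Fin n → Term) → Dec (Balanced f)
balanced? f = (sumℤ (coefficient ∘ f) ℤ.≟ 0ℤ) ×-dec (sumℤ (constant ∘ f) ℤ.≟ 0ℤ)

sumℤ-eval : ∀ {n} m (f : Fin n → Term) → sumℤ (eval m ∘ f) ≡ sumℤ (coefficient ∘ f) * m + sumℤ (constant ∘ f)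
sumℤ-eval {zero}  m f = refl
sumℤ-eval {suc n} m f =
  trans (cong₂ _+_ (eval-linear m (f 0F)) (sumℤ-eval m (f ∘ Fin.suc)))
        (regroup (coefficient (f 0F)) (constant (f 0F)) (sumℤ (coefficient ∘ f ∘ Fin.suc)) (sumℤ (constant ∘ f ∘ Fin.suc)) m)
  where
  regroup : ∀ c d C D m → c * m + d + (C * m + D) ≡ (c + C) * m + (d + D)
  regroup = solve-∀

balanced⇒sum≡0 : ∀ {n} m (f : Fin n → Term) → Balanced f → sumℤ (eval m ∘ f) ≡ 0ℤ
balanced⇒sum≡0 m f (coefficients≡0 , constants≡0) =
  trans (sumℤ-eval m f) (cong₂ (λ c d → c * m + d) coefficients≡0 constants≡0)

-- Consecutive segments of values

start : List ℕ → ℕ → ℕ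
start Ls r = sum (take r Ls)

-- Ls lists the lengths of consecutive segments of ℕ, followed by a last segment of length B.
InSegment : List ℕ → ℕ → ℕ → ℕ → Set
InSegment []       B zero    u = u < B
InSegment []       B (suc r) u = ⊥
InSegment (L ∷ Ls) B zero    u = u < L
InSegment (L ∷ Ls) B (suc r) u = InSegment Ls B r u

inSegment? : ∀ Ls B r u → Dec (InSegment Ls B r u)
inSegment? []       B zero    u = u ℕ.<? B
inSegment? []       B (suc r) u = no λ ()
inSegment? (L ∷ Ls) B zero    u = u ℕ.<? L
inSegment? (L ∷ Ls) B (suc r) u = inSegment? Ls B r u

locate : List ℕ → ℕ → ℕ × ℕ
locate []       u = 0 , u
locate (L ∷ Ls) u with u ℕ.<? L
... | yes _ = 0 , u
... | no  _ = map₁ suc (locate Ls (u ∸ L))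

locate-start : ∀ Ls B r u → InSegment Ls B r u → locate Ls (start Ls r ℕ.+ u) ≡ (r , u)
locate-start []       B zero    u _ = refl
locate-start (L ∷ Ls) B zero    u u<L with u ℕ.<? L
... | yes _   = refl
... | no  u≮L = contradiction u<L u≮L
locate-start (L ∷ Ls) B (suc r) u seg with L ℕ.+ start Ls r ℕ.+ u ℕ.<? L
... | yes lt = contradiction (ℕP.≤-<-trans (ℕP.≤-trans (ℕP.m≤m+n L _) (ℕP.m≤m+n _ u)) lt) (ℕP.<-irrefl refl)
... | no  _ rewrite ℕP.+-assoc L (start Ls r) u | ℕP.m+n∸m≡n L (start Ls r ℕ.+ u)
                  | locate-start Ls B r u seg = refl

start+<total : ∀ Ls B r u → InSegment Ls B r u → start Ls r ℕ.+ u < sum Ls ℕ.+ B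
start+<total []       B zero    u u<B = u<B
start+<total (L ∷ Ls) B zero    u u<L = ℕP.<-≤-trans u<L (ℕP.≤-trans (ℕP.m≤m+n L _) (ℕP.m≤m+n _ B))
start+<total (L ∷ Ls) B (suc r) u seg rewrite ℕP.+-assoc L (start Ls r) u | ℕP.+-assoc L (sum Ls) B =
  ℕP.+-monoʳ-< L (start+<total Ls B r u seg)

affine : ℕ → ℕ × ℕ → ℕ
affine M (c , k) = c ℕ.+ k ℕ.* M

start-affine : ∀ M layout r →
               start (map (affine M) layout) r ≡ start (map proj₁ layout) r ℕ.+ start (map proj₂ layout) r ℕ.* M
start-affine M []             zero    = refl
start-affine M []             (suc r) = refl
start-affine M (_ ∷ _)        zero    = refl
start-affine M ((c , k) ∷ ls) (suc r) =
  trans (cong (c ℕ.+ k ℕ.* M ℕ.+_) (start-affine M ls r)) (regroup c k M _ _)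
  where
  regroup : ∀ c k M s t → c ℕ.+ k ℕ.* M ℕ.+ (s ℕ.+ t ℕ.* M) ≡ c ℕ.+ s ℕ.+ (k ℕ.+ t) ℕ.* M
  regroup = ℕSolver.solve-∀

[c+r*n]<m*n : ∀ {c r n m} → c < n → r < m → c ℕ.+ r ℕ.* n < m ℕ.* n
[c+r*n]<m*n {c} {r} {n} {m} c<n r<m = ℕP.<-≤-trans (ℕP.+-monoˡ-< (r ℕ.* n) c<n) (ℕP.*-monoˡ-≤ n r<m)

b+w*2<2*m : ∀ {b w m} → b < 2 → w < m → b ℕ.+ w ℕ.* 2 < 2 ℕ.* m
b+w*2<2*m {b} {w} {m} b<2 w<m = subst (b ℕ.+ w ℕ.* 2 <_) (ℕP.*-comm m 2) ([c+r*n]<m*n b<2 w<m)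

[m+kn]%n≡m : ∀ m k n .{{_ : ℕ.NonZero n}} → m < n → (m ℕ.+ k ℕ.* n) % n ≡ m
[m+kn]%n≡m m k n m<n = trans (ℕD.[m+kn]%n≡m%n m k n) (ℕD.m<n⇒m%n≡m m<n)

[m+kn]/n≡k : ∀ m k n .{{_ : ℕ.NonZero n}} → m < n → (m ℕ.+ k ℕ.* n) / n ≡ k
[m+kn]/n≡k m k n m<n = begin
  (m ℕ.+ k ℕ.* n) / n    ≡⟨ ℕD.+-distrib-/-∣ʳ m (ℕDiv.n∣m*n k) ⟩
  m / n ℕ.+ k ℕ.* n / n  ≡⟨ cong₂ ℕ._+_ (ℕD.m<n⇒m/n≡0 m<n) (ℕD.m*n/n≡m k n) ⟩
  k                      ∎
  where open ≡-Reasoning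

[i+kn]mod-n≡i : ∀ {n} .{{_ : ℕ.NonZero n}} (i : Fin n) k → (toℕ i ℕ.+ k ℕ.* n) ℕD.mod n ≡ i
[i+kn]mod-n≡i i k = FinP.toℕ-injective (trans (FinP.toℕ-fromℕ< _) ([m+kn]%n≡m (toℕ i) k _ (FinP.toℕ<n i)))

m∸[1+[m∸[1+n]]]≡n : ∀ {m n} → n < m → m ∸ suc (m ∸ suc n) ≡ n
m∸[1+[m∸[1+n]]]≡n {m} {n} n<m = begin
  m ∸ suc w              ≡⟨ cong (_∸ suc w) (ℕP.m∸n+n≡m n<m) ⟨
  w ℕ.+ suc n ∸ suc w    ≡⟨ cong (_∸ suc w) (ℕP.+-suc w n) ⟩
  suc (w ℕ.+ n) ∸ suc w  ≡⟨ ℕP.m+n∸m≡n w n ⟩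
  n                      ∎
  where
  open ≡-Reasoning
  w = m ∸ suc n

≡3+[m/4]*4 : ∀ m → m % 4 ≡ 3 → m ≡ 3 ℕ.+ m / 4 ℕ.* 4
≡3+[m/4]*4 m m%4≡3 = trans (ℕD.m≡m%n+[m/n]*n m 4) (cong (ℕ._+ m / 4 ℕ.* 4) m%4≡3)

injective⇒surjective : ∀ {n} (f : Fin n → Fin n) → Injective _≡_ _≡_ f → ∀ y → ∃ λ x → f x ≡ y
injective⇒surjective {zero}  f inj ()
injective⇒surjective {suc n} f inj y with FinP.any? (λ x → f x FinP.≟ y)
... | yes hit = hit
... | no miss = contradiction (FinP.injective⇒≤ punched-injective) ℕP.1+n≰n
  where
  f≢y : ∀ x → y ≢ f x
  f≢y x eq = miss (x , sym eq)
  punched : Fin (suc n) → Fin n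
  punched x = Fin.punchOut (f≢y x)
  punched-injective : Injective _≡_ _≡_ punched
  punched-injective {x} {x′} eq = inj (FinP.punchOut-injective (f≢y x) (f≢y x′) eq)

NonzeroWithin : ℕ → ℤ → Set
NonzeroWithin N z = z ≢ 0ℤ × ∣ z ∣ ≤ N

signedIndex : ℕ → ℤ → ℕ
signedIndex N (+ n)    = n ∸ 1
signedIndex N -[1+ n ] = N ℕ.+ n

signedIndex< : ∀ N z → NonzeroWithin N z → signedIndex N z < 2 ℕ.* N
signedIndex< N (+ zero)  (z≢0 , _) = contradiction refl z≢0
signedIndex< N (+ suc n) (_ , n<N) = ℕP.<-≤-trans n<N (ℕP.m≤m+n N _)
signedIndex< N -[1+ n ]  (_ , n<N) = ℕP.+-monoʳ-< N (ℕP.<-≤-trans n<N (ℕP.≤-reflexive (sym (ℕP.+-identityʳ N))))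

signedIndex-injective : ∀ N y z → NonzeroWithin N y → NonzeroWithin N z → signedIndex N y ≡ signedIndex N z → y ≡ z
signedIndex-injective N (+ zero) _ (y≢0 , _) _ _ = contradiction refl y≢0
signedIndex-injective N _ (+ zero) _ (z≢0 , _) _ = contradiction refl z≢0
signedIndex-injective N (+ suc m) (+ suc n) _ _ eq = cong (λ k → + suc k) eq
signedIndex-injective N (+ suc m) -[1+ n ] (_ , m<N) _ eq = contradiction (subst (_< N) eq m<N) (ℕP.m+n≮m N n)
signedIndex-injective N -[1+ m ] (+ suc n) _ (_ , n<N) eq = contradiction (subst (_< N) (sym eq) n<N) (ℕP.m+n≮m N m)
signedIndex-injective N -[1+ m ] -[1+ n ] _ _ eq = cong -[1+_] (ℕP.+-cancelˡ-≡ N m n eq)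

every-value-once : ∀ {C : Set} {N} → C ↔ Fin (2 ℕ.* N) → (f : C → ℤ) → Injective _≡_ _≡_ f →
                   (∀ c → NonzeroWithin N (f c)) → ∀ ω → NonzeroWithin N ω →
                   Σ C λ c → f c ≡ ω × ∀ c′ → f c′ ≡ ω → c′ ≡ c
every-value-once {C} {N} C↔ f f-injective f-range ω ω-range = c , f-c≡ω , λ c′ eq → f-injective (trans eq (sym f-c≡ω))
  where
  open Inverse C↔ using (to; from; strictlyInverseˡ)
  g : Fin (2 ℕ.* N) → Fin (2 ℕ.* N)
  g x = fromℕ< (signedIndex< N (f (from x)) (f-range (from x)))
  g-injective : Injective _≡_ _≡_ g
  g-injective {x} {y} eq = trans (sym (strictlyInverseˡ x)) (trans (cong to (f-injective f-eq)) (strictlyInverseˡ y))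
    where
    f-eq : f (from x) ≡ f (from y)
    f-eq = signedIndex-injective N _ _ (f-range (from x)) (f-range (from y)) (FinP.fromℕ<-injective _ _ _ _ eq)
  hit : ∃ λ x → g x ≡ fromℕ< (signedIndex< N ω ω-range)
  hit = injective⇒surjective g g-injective _
  c : C
  c = from (proj₁ hit)
  f-c≡ω : f c ≡ ω
  f-c≡ω = signedIndex-injective N _ _ (f-range c) ω-range (FinP.fromℕ<-injective _ _ _ _ (proj₂ hit))

Ω-double : ∀ K {z} → Ω (K ℕ.* 2) z ⇔ NonzeroWithin K z
Ω-double K {z} = subst (λ N → Ω (K ℕ.* 2) z ⇔ NonzeroWithin N z) (ℕD.m*n/n≡m K 2) (Ω-even (ℕD.m*n%n≡0 K 2))
  where
  Ω-even : ∀ {N} → N % 2 ≡ 0 → Ω N z ⇔ NonzeroWithin (N / 2) z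
  Ω-even {N} even with N % 2
  ... | 0 = mk⇔ id id
  ... | suc _ with () ← even

-- The corner and the gadgets

arraySign : Fin 2 → Sign
arraySign 0F = ⊕
arraySign 1F = ⊖

_⊙_ : Sign → Term → Term
s ⊙ (σ [ a m+ b ]) = (s Sign.* σ) [ a m+ b ]

corner : Fin 3 → Fin 3 → Term
corner 0F 0F = ⊕ [ 0 m+ 1 ]
corner 0F 1F = ⊕ [ 4 m+ 13 ]
corner 0F 2F = ⊖ [ 4 m+ 14 ]
corner 1F 0F = ⊕ [ 6 m+ 20 ]
corner 1F 1F = ⊖ [ 4 m+ 15 ]
corner 1F 2F = ⊖ [ 2 m+ 5 ]
corner 2F 0F = ⊖ [ 6 m+ 21 ]
corner 2F 1F = ⊕ [ 0 m+ 2 ]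
corner 2F 2F = ⊕ [ 6 m+ 19 ]

gadget : Fin 2 → Fin 3 → Fin 4 → Term
gadget 0F 0F 0F = ⊕ [ 0 m+ 3 ]
gadget 0F 0F 1F = ⊖ [ 0 m+ 3 ]
gadget 0F 0F 2F = ⊕ [ 5 m+ 16 ]
gadget 0F 0F 3F = ⊖ [ 5 m+ 16 ]
gadget 0F 1F 0F = ⊕ [ 2 m+ 4 ]
gadget 0F 1F 1F = ⊖ [ 3 m+ 9 ]
gadget 0F 1F 2F = ⊖ [ 2 m+ 4 ]
gadget 0F 1F 3F = ⊕ [ 3 m+ 9 ]
gadget 0F 2F 0F = ⊖ [ 2 m+ 7 ]
gadget 0F 2F 1F = ⊕ [ 3 m+ 12 ]
gadget 0F 2F 2F = ⊖ [ 3 m+ 12 ]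
gadget 0F 2F 3F = ⊕ [ 2 m+ 7 ]
gadget 1F 0F 0F = ⊕ [ 2 m+ 6 ]
gadget 1F 0F 1F = ⊖ [ 2 m+ 6 ]
gadget 1F 0F 2F = ⊕ [ 2 m+ 8 ]
gadget 1F 0F 3F = ⊖ [ 2 m+ 8 ]
gadget 1F 1F 0F = ⊕ [ 3 m+ 11 ]
gadget 1F 1F 1F = ⊖ [ 3 m+ 11 ]
gadget 1F 1F 2F = ⊕ [ 3 m+ 10 ]
gadget 1F 1F 3F = ⊖ [ 3 m+ 10 ]
gadget 1F 2F 0F = ⊖ [ 5 m+ 17 ]
gadget 1F 2F 1F = ⊕ [ 5 m+ 17 ]
gadget 1F 2F 2F = ⊖ [ 5 m+ 18 ]
gadget 1F 2F 3F = ⊕ [ 5 m+ 18 ]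

smallTerm : Fin 2 → Fin 3 → Line → Term
smallTerm κ i (border j)  = arraySign κ ⊙ corner i j
smallTerm κ i (block _ l) = gadget κ i l

corner-rows : ∀ κ i → Balanced (λ j → smallTerm κ i (border j))
corner-rows = from-yes (all? λ κ → all? λ i → balanced? (λ j → smallTerm κ i (border j)))

corner-columns : ∀ κ j → Balanced (λ i → smallTerm κ i (border j))
corner-columns = from-yes (all? λ κ → all? λ j → balanced? (λ i → smallTerm κ i (border j)))

gadget-rows : ∀ κ i → Balanced (gadget κ i)
gadget-rows = from-yes (all? λ κ → all? λ i → balanced? (gadget κ i))

gadget-columns : ∀ κ l → Balanced (λ i → gadget κ i l)
gadget-columns = from-yes (all? λ κ → all? λ l → balanced? (λ i → gadget κ i l))

-- The arrays

module Construction (p q₀ : ℕ) where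

  q n M Q : ℕ
  q = suc q₀
  n = p ℕ.+ q₀
  M = n ℕ.+ n
  Q = q ℕ.* 4

  m : ℤ
  m = + M

  bodySize : ℕ
  bodySize = p ℕ.* 4 ℕ.* Q

  -- Lengths c + kM of the segments cutting 1, …, 6M + 21: the constant ones hold the values of the
  -- corner and the gadgets, the others the x-values of the families (segment 1) and their y- and
  -- (x + y)-values (segments 3, 5 for rows 0, 1 and 7, 9 for rows 2, 3).  The body values follow.
  layout : List (ℕ × ℕ)
  layout = (3 , 0) ∷ (0 , 2) ∷ (5 , 0) ∷ (0 , 1) ∷ (4 , 0) ∷ (0 , 1) ∷ (3 , 0) ∷ (0 , 1) ∷ (3 , 0) ∷ (0 , 1) ∷ (3 , 0) ∷ []

  frame : List ℕ
  frame = map (affine M) layout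

  value : ℕ → ℕ → ℕ
  value r u = suc (start frame r ℕ.+ u)

  slopeOf interceptOf : ℕ → ℕ
  slopeOf r = start (map proj₂ layout) r
  interceptOf r = suc (start (map proj₁ layout) r)

  value≡ : ∀ r u → + value r u ≡ + slopeOf r * m + + (interceptOf r ℕ.+ u)
  value≡ r u = begin
    + suc (start frame r ℕ.+ u)    ≡⟨ cong (λ s → + suc (s ℕ.+ u)) (start-affine M layout r) ⟩
    + suc (C ℕ.+ K ℕ.* M ℕ.+ u)    ≡⟨ cong +_ (regroup C K M u) ⟩
    + (K ℕ.* M) + + (suc C ℕ.+ u)  ≡⟨ cong (_+ + (suc C ℕ.+ u)) (ℤP.pos-* K M) ⟩
    + K * m + + (suc C ℕ.+ u)      ∎
    where
    open ≡-Reasoning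
    C = start (map proj₁ layout) r
    K = slopeOf r
    regroup : ∀ C K M u → suc (C ℕ.+ K ℕ.* M ℕ.+ u) ≡ K ℕ.* M ℕ.+ (suc C ℕ.+ u)
    regroup = ℕSolver.solve-∀

  xOdd xEven yOdd yEven : ℤ → ℤ
  xOdd  t = + 2 * m + + 3 - + 2 * t
  xEven t = + 2 * m + + 2 - + 2 * t
  yOdd  t = + 2 * m + + 9 + t
  yEven t = + 4 * m + + 16 + t

  half : Fin 4 → Fin 2
  half 0F = 0F
  half 1F = 0F
  half 2F = 1F
  half 3F = 1F

  parity : Fin 4 → ℕ
  parity 0F = 0
  parity 1F = 1
  parity 2F = 0
  parity 3F = 1

  familyPair : Fin 2 → ℤ → ℤ × ℤ
  familyPair 0F t = xOdd t , yOdd t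
  familyPair 1F t = xEven t , yEven t

  time : ℕ → Fin 4 → ℕ
  time G k = parity k ℕ.+ G ℕ.* 2

  family : ℕ → Fin 4 → Fin 3 → ℤ
  family G k j = blockSign k · triple (familyPair (half k) (+ time G k)) j

  family-row : ∀ G k → sumℤ (family G k) ≡ 0ℤ
  family-row G k = sumℤ-·≡0 (blockSign k) (triple xy) (triple-sum xy)
    where xy = familyPair (half k) (+ time G k)

  family-column : ∀ G j → sumℤ (λ k → family G k j) ≡ 0ℤ
  family-column G 0F = x-cancels m (+ (G ℕ.* 2))
    where
    x-cancels : ∀ m t → (+ 2 * m + + 3 - + 2 * t) + (- (+ 2 * m + + 3 - + 2 * (+ 1 + t))
                        + (- (+ 2 * m + + 2 - + 2 * t) + ((+ 2 * m + + 2 - + 2 * (+ 1 + t)) + 0ℤ))) ≡ 0ℤ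
    x-cancels = solve-∀
  family-column G 1F = y-cancels m (+ (G ℕ.* 2))
    where
    y-cancels : ∀ m t → (+ 2 * m + + 9 + t) + (- (+ 2 * m + + 9 + (+ 1 + t))
                        + (- (+ 4 * m + + 16 + t) + ((+ 4 * m + + 16 + (+ 1 + t)) + 0ℤ))) ≡ 0ℤ
    y-cancels = solve-∀
  family-column G 2F = z-cancels m (+ (G ℕ.* 2))
    where
    z-cancels : ∀ m t → - ((+ 2 * m + + 3 - + 2 * t) + (+ 2 * m + + 9 + t))
                        + (- - ((+ 2 * m + + 3 - + 2 * (+ 1 + t)) + (+ 2 * m + + 9 + (+ 1 + t)))
                        + (- - ((+ 2 * m + + 2 - + 2 * t) + (+ 4 * m + + 16 + t))
                        + (- ((+ 2 * m + + 2 - + 2 * (+ 1 + t)) + (+ 4 * m + + 16 + (+ 1 + t))) + 0ℤ))) ≡ 0ℤ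
    z-cancels = solve-∀

  bodyOffset : ℕ → Fin 4 → ℕ → Fin 4 → ℕ
  bodyOffset g k h l = toℕ l ℕ.+ h ℕ.* 4 ℕ.+ (toℕ k ℕ.+ g ℕ.* 4) ℕ.* Q

  entry : Fin 2 → Line → Line → ℤ
  entry κ (border i)  y@(border _)      = eval m (smallTerm κ i y)
  entry κ (border i)  y@(block zero _)  = eval m (smallTerm κ i y)
  entry κ (border i)  (block (suc G) l) = arraySign κ · family G l i
  entry κ (block g k) (border j)        = arraySign κ · family (q₀ ℕ.+ g) k j
  entry κ (block g k) (block h l)       = arraySign κ · (blockSign k · (blockSign l · + value 11 (bodyOffset g k h l)))

  body-row : ∀ g k h → sumℤ (λ l → blockSign l · + value 11 (bodyOffset g k h l)) ≡ 0ℤ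
  body-row g k h = alternating-progression _ _ 1 (λ l → progression (start frame 11) (toℕ l) h (toℕ k ℕ.+ g ℕ.* 4) Q)
    where
    progression : ∀ S l h R Q → suc (S ℕ.+ (l ℕ.+ h ℕ.* 4 ℕ.+ R ℕ.* Q)) ≡ suc (S ℕ.+ (h ℕ.* 4 ℕ.+ R ℕ.* Q)) ℕ.+ l ℕ.* 1
    progression = ℕSolver.solve-∀

  body-column : ∀ g h l → sumℤ (λ k → blockSign k · + value 11 (bodyOffset g k h l)) ≡ 0ℤ
  body-column g h l = alternating-progression _ _ Q (λ k → progression (start frame 11) (toℕ l ℕ.+ h ℕ.* 4) (toℕ k) g Q)
    where
    progression : ∀ S C k g Q → suc (S ℕ.+ (C ℕ.+ (k ℕ.+ g ℕ.* 4) ℕ.* Q)) ≡ suc (S ℕ.+ (C ℕ.+ g ℕ.* 4 ℕ.* Q)) ℕ.+ k ℕ.* Q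
    progression = ℕSolver.solve-∀

  row-border : ∀ κ x → sumℤ (λ j → entry κ x (border j)) ≡ 0ℤ
  row-border κ (border i)  = balanced⇒sum≡0 m (λ j → smallTerm κ i (border j)) (corner-rows κ i)
  row-border κ (block g k) = sumℤ-·≡0 (arraySign κ) (family (q₀ ℕ.+ g) k) (family-row (q₀ ℕ.+ g) k)

  row-block : ∀ κ x h → sumℤ (λ l → entry κ x (block h l)) ≡ 0ℤ
  row-block κ (border i)  zero    = balanced⇒sum≡0 m (gadget κ i) (gadget-rows κ i)
  row-block κ (border i)  (suc G) = sumℤ-·≡0 (arraySign κ) (λ l → family G l i) (family-column G i)
  row-block κ (block g k) h       =
    sumℤ-·≡0 (arraySign κ) (λ l → blockSign k · (blockSign l · body l))
             (sumℤ-·≡0 (blockSign k) (λ l → blockSign l · body l) (body-row g k h))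
    where body = λ l → + value 11 (bodyOffset g k h l)

  column-border : ∀ κ y → sumℤ (λ i → entry κ (border i) y) ≡ 0ℤ
  column-border κ (border j)        = balanced⇒sum≡0 m (λ i → smallTerm κ i (border j)) (corner-columns κ j)
  column-border κ (block zero l)    = balanced⇒sum≡0 m (λ i → gadget κ i l) (gadget-columns κ l)
  column-border κ (block (suc G) l) = sumℤ-·≡0 (arraySign κ) (family G l) (family-row G l)

  column-block : ∀ κ y g → sumℤ (λ k → entry κ (block g k) y) ≡ 0ℤ
  column-block κ (border j)  g = sumℤ-·≡0 (arraySign κ) (λ k → family (q₀ ℕ.+ g) k j) (family-column (q₀ ℕ.+ g) j)
  column-block κ (block h l) g =
    sumℤ-·≡0 (arraySign κ) (λ k → blockSign k · (blockSign l · body k))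
             (trans (sumℤ-cong λ k → ·-comm (blockSign k) (blockSign l) (body k))
                    (sumℤ-·≡0 (blockSign l) (λ k → blockSign k · body k) (body-column g h l)))
    where body = λ k → + value 11 (bodyOffset g k h l)

  row-sum : ∀ κ x → sumℤ {3 ℕ.+ Q} (λ j → entry κ x (line (toℕ j))) ≡ 0ℤ
  row-sum κ x = trans (sumℤ-toℕ (3 ℕ.+ Q) (entry κ x ∘ line)) (∑-lines q (entry κ x) (row-border κ x) (row-block κ x))

  column-sum : ∀ κ y → sumℤ {3 ℕ.+ p ℕ.* 4} (λ i → entry κ (line (toℕ i)) y) ≡ 0ℤ
  column-sum κ y = trans (sumℤ-toℕ (3 ℕ.+ p ℕ.* 4) (λ x → entry κ (line x) y))
                         (∑-lines p (λ x → entry κ x y) (column-border κ y) (column-block κ y))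

  Cell : Set
  Cell = Fin 2 × Line × Line

  arrayOf : Sign → Fin 2
  arrayOf ⊕ = 0F
  arrayOf ⊖ = 1F

  tripleSign : Fin 3 → Sign
  tripleSign 0F = ⊕
  tripleSign 1F = ⊕
  tripleSign 2F = ⊖

  row : Fin 2 → ℕ → Fin 4
  row 0F zero    = 0F
  row 0F (suc _) = 1F
  row 1F zero    = 2F
  row 1F (suc _) = 3F

  xBit : Fin 2 → ℕ
  xBit 0F = 1
  xBit 1F = 0

  halfOfBit : ℕ → Fin 2
  halfOfBit zero    = 1F
  halfOfBit (suc _) = 0F

  familyLines : ℕ → Fin 4 → Fin 3 → Line × Line
  familyLines G k j with G ℕ.<? q₀
  ... | yes _ = border j , block (suc G) k
  ... | no  _ = block (G ∸ q₀) k , border j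

  familyCell : Sign → ℕ → Fin 4 → Fin 3 → Cell
  familyCell s G k j = arrayOf (s Sign.* (blockSign k Sign.* tripleSign j)) , familyLines G k j

  familyPlace : Sign → Fin 2 → ℕ → Fin 3 → Cell
  familyPlace s h t j = familyCell s (t ℕ./ 2) (row h (t ℕ.% 2)) j

  bodyPlace : Sign → ℕ → Cell
  bodyPlace s u = arrayOf (s Sign.* (blockSign k Sign.* blockSign l)) , block (R ℕ./ 4) k , block (C ℕ./ 4) l
    where
    R = u ℕ./ Q
    C = u ℕ.% Q
    k = R ℕD.mod 4
    l = C ℕD.mod 4

  constantSegment : ℕ → ℕ
  constantSegment 0 = 0
  constantSegment 2 = 2
  constantSegment 3 = 4
  constantSegment 4 = 6
  constantSegment 5 = 8
  constantSegment _ = 10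

  segmentOf : ℕ → ℕ → ℕ × ℕ
  segmentOf a b = constantSegment a , b ∸ interceptOf (constantSegment a)

  smallKey : Term → Sign × ℕ × ℕ
  smallKey (σ [ a m+ b ]) = σ , segmentOf a b

  smallCells : List (Fin 2 × Fin 3 × Line)
  smallCells = cartesianProduct (allFin 2) (cartesianProduct (allFin 3) (map border (allFin 3) ++ map (block 0) (allFin 4)))

  _≟ᵏ_ : DecidableEquality (Sign × ℕ × ℕ)
  _≟ᵏ_ = ≡-dec SignP._≟_ (≡-dec ℕ._≟_ ℕ._≟_)

  _≟ᶜ_ : DecidableEquality Cell
  _≟ᶜ_ = ≡-dec FinP._≟_ (≡-dec _≟ᴸ_ _≟ᴸ_)

  smallPlace : ℕ → ℕ → Sign → Cell
  smallPlace r u s with find (λ (κ , i , y) → smallKey (smallTerm κ i y) ≟ᵏ (s , r , u)) smallCells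
  ... | just (κ , i , y) = κ , border i , y
  ... | nothing          = 0F , border 0F , border 0F

  place : ℕ → ℕ → Sign → Cell
  place 1  u s = familyPlace s (halfOfBit (u ℕ.% 2)) (M ∸ suc (u ℕ./ 2)) 0F
  place 3  u s = familyPlace s 0F u 1F
  place 5  u s = familyPlace s 0F (M ∸ suc u) 2F
  place 7  u s = familyPlace s 1F u 1F
  place 9  u s = familyPlace s 1F (M ∸ suc u) 2F
  place 11 u s = bodyPlace s u
  place r  u s = smallPlace r u s

  decode : ℤ → Cell
  decode ω = place (proj₁ ru) (proj₂ ru) (sign ω)
    where ru = locate frame (∣ ω ∣ ∸ 1)

  record Code (κ : Fin 2) (x y : Line) : Set where
    constructor code
    field
      segment offset : ℕ
      codeSign       : Sign
      in-segment     : InSegment frame bodySize segment offset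
      entry≡         : entry κ x y ≡ codeSign · + value segment offset
      place≡         : place segment offset codeSign ≡ (κ , x , y)

  decode-entry : ∀ {κ x y} → Code κ x y → decode (entry κ x y) ≡ (κ , x , y)
  decode-entry (code r u s seg entry≡ place≡)
    rewrite entry≡ | sign-· s (start frame r ℕ.+ u) | abs-· s (value r u) | locate-start frame bodySize r u seg = place≡

  total-size : sum frame ℕ.+ bodySize ≡ (3 ℕ.+ p ℕ.* 4) ℕ.* (3 ℕ.+ Q)
  total-size = trans (cong (ℕ._+ bodySize) (start-affine M layout 11)) (count p q₀)
    where
    count : ∀ p q₀ → 21 ℕ.+ 6 ℕ.* ((p ℕ.+ q₀) ℕ.+ (p ℕ.+ q₀)) ℕ.+ p ℕ.* 4 ℕ.* (suc q₀ ℕ.* 4)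
                     ≡ (3 ℕ.+ p ℕ.* 4) ℕ.* (3 ℕ.+ suc q₀ ℕ.* 4)
    count = ℕSolver.solve-∀

  entry-range : ∀ {κ x y} → Code κ x y → NonzeroWithin ((3 ℕ.+ p ℕ.* 4) ℕ.* (3 ℕ.+ Q)) (entry κ x y)
  entry-range (code r u s seg entry≡ _) rewrite entry≡ = nonzero s , bound
    where
    nonzero : ∀ s → s · + value r u ≢ 0ℤ
    nonzero ⊕ ()
    nonzero ⊖ ()
    bound : ∣ s · + value r u ∣ ℕ.≤ (3 ℕ.+ p ℕ.* 4) ℕ.* (3 ℕ.+ Q)
    bound rewrite abs-· s (value r u) = subst (value r u ℕ.≤_) total-size (start+<total frame bodySize r u seg)

  entry-injective : ∀ {κ x y κ′ x′ y′} → Code κ x y → Code κ′ x′ y′ → entry κ x y ≡ entry κ′ x′ y′ → (κ , x , y) ≡ (κ′ , x′ , y′)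
  entry-injective c c′ eq = trans (sym (decode-entry c)) (trans (cong decode eq) (decode-entry c′))

  Locates : Term → Cell → Set
  Locates (σ [ a m+ b ]) c = let (r , u) = segmentOf a b in
    slopeOf r ≡ a × interceptOf r ℕ.+ u ≡ b × InSegment frame bodySize r u × place r u σ ≡ c

  locates? : ∀ t c → Dec (Locates t c)
  locates? (σ [ a m+ b ]) c = let (r , u) = segmentOf a b in
    (slopeOf r ℕ.≟ a) ×-dec (interceptOf r ℕ.+ u ℕ.≟ b) ×-dec inSegment? frame bodySize r u ×-dec (place r u σ ≟ᶜ c)

  term-code : ∀ {κ x y} t → entry κ x y ≡ eval m t → Locates t (κ , x , y) → Code κ x y
  term-code (σ [ a m+ b ]) entry≡ (slope≡ , intercept≡ , seg , place≡) = let (r , u) = segmentOf a b in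
    code r u σ seg (trans entry≡ (cong (σ ·_) (sym (trans (value≡ r u) (cong₂ (λ a b → + a * m + + b) slope≡ intercept≡))))) place≡

  corner-located : ∀ κ i j → Locates (smallTerm κ i (border j)) (κ , border i , border j)
  corner-located = from-yes (all? λ κ → all? λ i → all? λ j → locates? (smallTerm κ i (border j)) (κ , border i , border j))

  gadget-located : ∀ κ i l → Locates (smallTerm κ i (block 0 l)) (κ , border i , block 0 l)
  gadget-located = from-yes (all? λ κ → all? λ i → all? λ l → locates? (smallTerm κ i (block 0 l)) (κ , border i , block 0 l))

  m-split : ∀ {t} → t < M → m ≡ + (M ∸ suc t) + + 1 + + t
  m-split {t} t<M = cong +_ (sym (trans (ℕP.+-assoc (M ∸ suc t) 1 t) (ℕP.m∸n+n≡m t<M)))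

  x-value : ∀ b t → t < M → + 2 * m + (+ 2 + + b) - + 2 * + t ≡ + value 1 (b ℕ.+ (M ∸ suc t) ℕ.* 2)
  x-value b t t<M = trans (x-identity m (+ (M ∸ suc t)) (+ t) (+ b) (m-split t<M)) (cong (λ z → + 4 + (+ b + z)) (sym (ℤP.pos-* (M ∸ suc t) 2)))
    where
    x-identity : ∀ m w t b → m ≡ w + + 1 + t → + 2 * m + (+ 2 + b) - + 2 * t ≡ + 4 + (b + w * + 2)
    x-identity _ w t b refl = solve (w ∷ t ∷ b ∷ [])

  zOdd-value : ∀ t → t < M → xOdd (+ t) + yOdd (+ t) ≡ + value 5 (M ∸ suc t)
  zOdd-value t t<M = trans (z-identity m (+ (M ∸ suc t)) (+ t) (m-split t<M)) (sym (value≡ 5 (M ∸ suc t)))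
    where
    z-identity : ∀ m w t → m ≡ w + + 1 + t → + 2 * m + + 3 - + 2 * t + (+ 2 * m + + 9 + t) ≡ + 3 * m + (+ 13 + w)
    z-identity _ w t refl = solve (w ∷ t ∷ [])

  zEven-value : ∀ t → t < M → xEven (+ t) + yEven (+ t) ≡ + value 9 (M ∸ suc t)
  zEven-value t t<M = trans (z-identity m (+ (M ∸ suc t)) (+ t) (m-split t<M)) (sym (value≡ 9 (M ∸ suc t)))
    where
    z-identity : ∀ m w t → m ≡ w + + 1 + t → + 2 * m + + 2 - + 2 * t + (+ 4 * m + + 16 + t) ≡ + 5 * m + (+ 19 + w)
    z-identity _ w t refl = solve (w ∷ t ∷ [])

  familySegment : Fin 2 → Fin 3 → ℕ
  familySegment _  0F = 1
  familySegment 0F 1F = 3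
  familySegment 0F 2F = 5
  familySegment 1F 1F = 7
  familySegment 1F 2F = 9

  familyOffset : Fin 2 → Fin 3 → ℕ → ℕ
  familyOffset h 0F t = xBit h ℕ.+ (M ∸ suc t) ℕ.* 2
  familyOffset h 1F t = t
  familyOffset h 2F t = M ∸ suc t

  triple-value : ∀ h j t → t < M → triple (familyPair h (+ t)) j ≡ tripleSign j · + value (familySegment h j) (familyOffset h j t)
  triple-value 0F 0F t t<M = x-value 1 t t<M
  triple-value 1F 0F t t<M = x-value 0 t t<M
  triple-value 0F 1F t _   = trans (ℤP.+-assoc (+ 2 * m) (+ 9) (+ t)) (sym (value≡ 3 t))
  triple-value 1F 1F t _   = trans (ℤP.+-assoc (+ 4 * m) (+ 16) (+ t)) (sym (value≡ 7 t))
  triple-value 0F 2F t t<M = cong -_ (zOdd-value t t<M)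
  triple-value 1F 2F t t<M = cong -_ (zEven-value t t<M)

  xBit<2 : ∀ h → xBit h < 2
  xBit<2 0F = ℕ.s≤s (ℕ.s≤s ℕ.z≤n)
  xBit<2 1F = ℕ.s≤s ℕ.z≤n

  parity<2 : ∀ k → parity k < 2
  parity<2 0F = ℕ.s≤s ℕ.z≤n
  parity<2 1F = ℕ.s≤s (ℕ.s≤s ℕ.z≤n)
  parity<2 2F = ℕ.s≤s ℕ.z≤n
  parity<2 3F = ℕ.s≤s (ℕ.s≤s ℕ.z≤n)

  row-half-parity : ∀ k → row (half k) (parity k) ≡ k
  row-half-parity 0F = refl
  row-half-parity 1F = refl
  row-half-parity 2F = refl
  row-half-parity 3F = refl

  halfOfBit-xBit : ∀ h → halfOfBit (xBit h) ≡ h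
  halfOfBit-xBit 0F = refl
  halfOfBit-xBit 1F = refl

  arrayOf-cancel : ∀ κ s → arrayOf ((arraySign κ Sign.* s) Sign.* s) ≡ κ
  arrayOf-cancel 0F ⊕ = refl
  arrayOf-cancel 0F ⊖ = refl
  arrayOf-cancel 1F ⊕ = refl
  arrayOf-cancel 1F ⊖ = refl

  time<M : ∀ G k → G < n → time G k < M
  time<M G k G<n = subst (time G k <_) (cong (n ℕ.+_) (ℕP.+-identityʳ n)) (b+w*2<2*m (parity<2 k) G<n)

  family-in-segment : ∀ h j t → t < M → InSegment frame bodySize (familySegment h j) (familyOffset h j t)
  family-in-segment h  0F t t<M = b+w*2<2*m (xBit<2 h) (ℕP.∸-monoʳ-< (ℕ.s≤s ℕ.z≤n) t<M)
  family-in-segment 0F 1F t t<M = subst (t <_) (sym (ℕP.+-identityʳ M)) t<M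
  family-in-segment 1F 1F t t<M = subst (t <_) (sym (ℕP.+-identityʳ M)) t<M
  family-in-segment 0F 2F t t<M = subst (M ∸ suc t <_) (sym (ℕP.+-identityʳ M)) (ℕP.∸-monoʳ-< (ℕ.s≤s ℕ.z≤n) t<M)
  family-in-segment 1F 2F t t<M = subst (M ∸ suc t <_) (sym (ℕP.+-identityʳ M)) (ℕP.∸-monoʳ-< (ℕ.s≤s ℕ.z≤n) t<M)

  place-family : ∀ s h j t → t < M → place (familySegment h j) (familyOffset h j t) s ≡ familyPlace s h t j
  place-family s h 0F t t<M = cong₂ (λ h′ t′ → familyPlace s h′ t′ 0F)
    (trans (cong halfOfBit ([m+kn]%n≡m (xBit h) w 2 (xBit<2 h))) (halfOfBit-xBit h))
    (trans (cong (λ w′ → M ∸ suc w′) ([m+kn]/n≡k (xBit h) w 2 (xBit<2 h))) (m∸[1+[m∸[1+n]]]≡n t<M))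
    where w = M ∸ suc t
  place-family s 0F 1F t t<M = refl
  place-family s 1F 1F t t<M = refl
  place-family s 0F 2F t t<M = cong (λ t′ → familyPlace s 0F t′ 2F) (m∸[1+[m∸[1+n]]]≡n t<M)
  place-family s 1F 2F t t<M = cong (λ t′ → familyPlace s 1F t′ 2F) (m∸[1+[m∸[1+n]]]≡n t<M)

  familyPlace-time : ∀ s G k j → familyPlace s (half k) (time G k) j ≡ familyCell s G k j
  familyPlace-time s G k j = cong₂ (λ G′ k′ → familyCell s G′ k′ j)
    ([m+kn]/n≡k (parity k) G 2 (parity<2 k))
    (trans (cong (row (half k)) ([m+kn]%n≡m (parity k) G 2 (parity<2 k))) (row-half-parity k))

  familyCell-top : ∀ κ G k j → G < q₀ →
                   familyCell (arraySign κ Sign.* (blockSign k Sign.* tripleSign j)) G k j ≡ (κ , border j , block (suc G) k)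
  familyCell-top κ G k j G<q₀ = cong₂ _,_ (arrayOf-cancel κ _) lines
    where
    lines : familyLines G k j ≡ (border j , block (suc G) k)
    lines with G ℕ.<? q₀
    ... | yes _    = refl
    ... | no  G≮q₀ = contradiction G<q₀ G≮q₀

  familyCell-left : ∀ κ g k j →
                    familyCell (arraySign κ Sign.* (blockSign k Sign.* tripleSign j)) (q₀ ℕ.+ g) k j ≡ (κ , block g k , border j)
  familyCell-left κ g k j = cong₂ _,_ (arrayOf-cancel κ _) lines
    where
    lines : familyLines (q₀ ℕ.+ g) k j ≡ (block g k , border j)
    lines with q₀ ℕ.+ g ℕ.<? q₀
    ... | yes q₀+g<q₀ = contradiction q₀+g<q₀ (ℕP.m+n≮m q₀ g)
    ... | no  _       = cong (λ g′ → block g′ k , border j) (ℕP.m+n∸m≡n q₀ g)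

  family-code : ∀ {κ x y} G k j → G < n → entry κ x y ≡ arraySign κ · family G k j →
               familyCell (arraySign κ Sign.* (blockSign k Sign.* tripleSign j)) G k j ≡ (κ , x , y) → Code κ x y
  family-code {κ} G k j G<n entry≡ cell≡ = code (familySegment h j) (familyOffset h j t) s
    (family-in-segment h j t t<M)
    (trans entry≡ (trans (cong (λ v → arraySign κ · (blockSign k · v)) (triple-value h j t t<M))
                         (sym (·-*-* (arraySign κ) (blockSign k) (tripleSign j) _))))
    (trans (place-family s h j t t<M) (trans (familyPlace-time s G k j) cell≡))
    where
    h = half k
    t = time G k
    t<M = time<M G k G<n
    s = arraySign κ Sign.* (blockSign k Sign.* tripleSign j)

  body-code : ∀ κ g k h l → g < p → h < q → Code κ (block g k) (block h l)
  body-code κ g k h l g<p h<q = code 11 (C ℕ.+ R ℕ.* Q) s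
    ([c+r*n]<m*n C<Q ([c+r*n]<m*n (FinP.toℕ<n k) g<p))
    (sym (·-*-* (arraySign κ) (blockSign k) (blockSign l) _))
    placed
    where
    C = toℕ l ℕ.+ h ℕ.* 4
    R = toℕ k ℕ.+ g ℕ.* 4
    C<Q = [c+r*n]<m*n (FinP.toℕ<n l) h<q
    s = arraySign κ Sign.* (blockSign k Sign.* blockSign l)
    placed : bodyPlace s (C ℕ.+ R ℕ.* Q) ≡ (κ , block g k , block h l)
    placed rewrite [m+kn]/n≡k C R Q C<Q | [m+kn]%n≡m C R Q C<Q | [i+kn]mod-n≡i k g | [i+kn]mod-n≡i l h
                 | [m+kn]/n≡k (toℕ k) g 4 (FinP.toℕ<n k) | [m+kn]/n≡k (toℕ l) h 4 (FinP.toℕ<n l)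
                 | arrayOf-cancel κ (blockSign k Sign.* blockSign l) = refl

  cell-code : ∀ κ x y → ValidLine p x → ValidLine q y → Code κ x y
  cell-code κ (border i)  (border j)        _   _            = term-code _ refl (corner-located κ i j)
  cell-code κ (border i)  (block zero l)    _   _            = term-code _ refl (gadget-located κ i l)
  cell-code κ (border i)  (block (suc G) l) _   (ℕ.s≤s G<q₀) =
    family-code G l i (ℕP.<-≤-trans G<q₀ (ℕP.m≤n+m q₀ p)) refl (familyCell-top κ G l i G<q₀)
  cell-code κ (block g k) (border j)        g<p _            =
    family-code (q₀ ℕ.+ g) k j (subst (q₀ ℕ.+ g <_) (ℕP.+-comm q₀ p) (ℕP.+-monoʳ-< q₀ g<p)) refl (familyCell-left κ g k j)
  cell-code κ (block g k) (block h l)       g<p h<q          = body-code κ g k h l g<p h<q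

smas : ∀ p q₀ → SMAS (3 ℕ.+ p ℕ.* 4) (3 ℕ.+ suc q₀ ℕ.* 4) 2
smas p q₀ = A , record
  { entries-in-Ω = λ κ i j → Equivalence.from (Ω-double (a ℕ.* b)) (range (κ , i , j))
  ; each-once    = λ ω ω∈Ω →
      let (c , A≡ω , unique) = every-value-once positions↔ entryAt entryAt-injective range ω
                                                (Equivalence.to (Ω-double (a ℕ.* b)) ω∈Ω)
      in  c , A≡ω , λ κ i j → unique (κ , i , j)
  ; rows-zero    = λ κ i → row-sum κ (line (toℕ i))
  ; cols-zero    = λ κ j → column-sum κ (line (toℕ j))
  }
  where
  open Construction p q₀
  a b : ℕ
  a = 3 ℕ.+ p ℕ.* 4
  b = 3 ℕ.+ Q
  A : Arrays a b 2
  A κ i j = entry κ (line (toℕ i)) (line (toℕ j))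
  Position : Set
  Position = Fin 2 × Fin a × Fin b
  entryAt : Position → ℤ
  entryAt (κ , i , j) = A κ i j
  positions↔ : Position ↔ Fin (2 ℕ.* (a ℕ.* b))
  positions↔ = ↔-sym (↔-trans FinP.*↔× (↔-refl ×-↔ FinP.*↔×))
  code-at : ∀ c → Code (proj₁ c) (line (toℕ (proj₁ (proj₂ c)))) (line (toℕ (proj₂ (proj₂ c))))
  code-at (κ , i , j) = cell-code κ _ _ (line-valid p (toℕ i) (FinP.toℕ<n i)) (line-valid q (toℕ j) (FinP.toℕ<n j))
  range : ∀ c → NonzeroWithin (a ℕ.* b) (entryAt c)
  range c = entry-range (code-at c)
  entryAt-injective : Injective _≡_ _≡_ entryAt
  entryAt-injective {κ , i , j} {κ′ , i′ , j′} eq with entry-injective (code-at (κ , i , j)) (code-at (κ′ , i′ , j′)) eq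
  ... | same rewrite FinP.toℕ-injective (line-injective (cong (proj₁ ∘ proj₂) same))
                   | FinP.toℕ-injective (line-injective (cong (proj₂ ∘ proj₂) same)) | cong proj₁ same = refl

lemma3p10 : (a b : ℕ) → 7 ≤ a → 7 ≤ b → a % 4 ≡ 3 → b % 4 ≡ 3 → SMAS a b 2
lemma3p10 a b _ 7≤b a%4≡3 b%4≡3 with b / 4 | ≡3+[m/4]*4 b b%4≡3
... | zero   | b≡3 = contradiction (subst (7 ≤_) b≡3 7≤b) λ { (ℕ.s≤s (ℕ.s≤s (ℕ.s≤s ()))) }
... | suc q₀ | b≡  = subst₂ (λ a b → SMAS a b 2) (sym (≡3+[m/4]*4 a a%4≡3)) (sym b≡) (smas (a / 4) q₀)
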